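{- Let $f:\mathbb{N}\to\mathbb{N}$ be strictly increasing and, for each $k\in\mathbb{N}$, let $A(k)$ be a statement. For $k\ge f(0)$ define $k^*:=\max\{n\in\mathbb{N}: f(n)\le k\}$. Then for every $g:\mathbb{N}\to\mathbb{N}$ and every $n\in\mathbb{N}$ the following holds: putting $\tilde g(n):=\bigl(f(n)+g(f(n))\bigr)^*-n$ and $m:=f(n)$, if $A(k)$ holds for all $k\in[n;n+\tilde g(n)]$, then $A(k^*)$ holds for all $k\in[m;m+g(m)]$.
   Context: For $n,m\in\mathbb{N}$, $[n;n+m]:=\{n,n+1,\dots,n+m\}$. -}

module Defs where

open import Data.Nat using (ℕ; zero; suc; _≤_; _<_; _≤?_)
open import Relation.Nullary using (yes; no)

StrictlyIncreasing : (ℕ → ℕ) → Set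
StrictlyIncreasing f = ∀ {a b} → a < b → f a < f b

lastBelow : (ℕ → ℕ) → ℕ → ℕ → ℕ
lastBelow f k zero = zero
lastBelow f k (suc i) with f (suc i) ≤? k
... | yes _ = suc i
... | no  _ = lastBelow f k i

-- k* := max { n : f n ≤ k }.  For strictly increasing f we have n ≤ f n,
-- so every such n satisfies n ≤ k and the search over [0;k] is exhaustive.
-- (Meaningful for k ≥ f 0; for k < f 0 the value 0 is a junk default.)
star : (ℕ → ℕ) → ℕ → ℕ
star f k = lastBelow f k k

-- The map k ↦ k* is monotone and satisfies n ≤ k* whenever f n ≤ k.  Hence for
-- f n ≤ k ≤ f n + g (f n) the index k* lies between n and (f n + g (f n))*,
-- which is exactly the interval [n; n + g̃ n] on which A is assumed to hold.
module Submission where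

open import Defs
open import Data.Nat using (ℕ; zero; suc; _+_; _∸_; _≤_; _≤′_; _≤?_; z≤n; s≤s; ≤′-refl; ≤′-step)
open import Data.Nat.Properties
open import Data.Sum using (inj₁; inj₂)
open import Relation.Nullary using (yes; no; contradiction)
open import Relation.Binary.PropositionalEquality using (refl; sym)

lastBelow-≤ : ∀ f k i → lastBelow f k i ≤ i
lastBelow-≤ f k zero = z≤n
lastBelow-≤ f k (suc i) with f (suc i) ≤? k
... | yes _ = ≤-refl
... | no  _ = m≤n⇒m≤1+n (lastBelow-≤ f k i)

lastBelow-monoˡ : ∀ f {k k′} → k ≤ k′ → ∀ i → lastBelow f k i ≤ lastBelow f k′ i
lastBelow-monoˡ f k≤k′ zero = z≤n
lastBelow-monoˡ f {k} {k′} k≤k′ (suc i) with f (suc i) ≤? k | f (suc i) ≤? k′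
... | yes _    | yes _    = ≤-refl
... | yes fi≤k | no fi≰k′ = contradiction (≤-trans fi≤k k≤k′) fi≰k′
... | no  _    | yes _    = m≤n⇒m≤1+n (lastBelow-≤ f k i)
... | no  _    | no  _    = lastBelow-monoˡ f k≤k′ i

lastBelow-suc : ∀ f k i → lastBelow f k i ≤ lastBelow f k (suc i)
lastBelow-suc f k i with f (suc i) ≤? k
... | yes _ = m≤n⇒m≤1+n (lastBelow-≤ f k i)
... | no  _ = ≤-refl

lastBelow-monoʳ : ∀ f k {i j} → i ≤′ j → lastBelow f k i ≤ lastBelow f k j
lastBelow-monoʳ f k ≤′-refl          = ≤-refl
lastBelow-monoʳ f k (≤′-step {j} i≤j) = ≤-trans (lastBelow-monoʳ f k i≤j) (lastBelow-suc f k j)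

≤-lastBelow : ∀ f k {j} i → j ≤ i → f j ≤ k → j ≤ lastBelow f k i
≤-lastBelow f k {zero}  i       _   _    = z≤n
≤-lastBelow f k {suc j} (suc i) j≤i fj≤k with f (suc i) ≤? k
... | yes _ = j≤i
... | no fi≰k with m≤n⇒m<n∨m≡n j≤i
...   | inj₁ (s≤s j<i) = ≤-lastBelow f k i j<i fj≤k
...   | inj₂ refl      = contradiction fj≤k fi≰k

≤-strictlyIncreasing : ∀ {f} → StrictlyIncreasing f → ∀ n → n ≤ f n
≤-strictlyIncreasing inc zero    = z≤n
≤-strictlyIncreasing inc (suc n) = ≤-trans (s≤s (≤-strictlyIncreasing inc n)) (inc (n<1+n n))

star-mono : ∀ f {k k′} → k ≤ k′ → star f k ≤ star f k′
star-mono f {k} {k′} k≤k′ =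
  ≤-trans (lastBelow-monoˡ f k≤k′ k) (lastBelow-monoʳ f k′ (≤⇒≤′ k≤k′))

-- The search range of star f k is [0;k]; it contains n because n ≤ f n ≤ k.
≤-star : ∀ {f} → StrictlyIncreasing f → ∀ {n k} → f n ≤ k → n ≤ star f k
≤-star {f} inc {n} {k} fn≤k =
  ≤-lastBelow f k k (≤-trans (≤-strictlyIncreasing inc n) fn≤k) fn≤k

lemma3p4 : (f : ℕ → ℕ) → StrictlyIncreasing f → (A : ℕ → Set) →
    (g : ℕ → ℕ) → (n : ℕ) →
    (∀ k → n ≤ k → k ≤ n + (star f (f n + g (f n)) ∸ n) → A k) →
    ∀ k → f n ≤ k → k ≤ f n + g (f n) → A (star f k)
lemma3p4 f inc A g n A-on-range k fn≤k k≤end =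
  A-on-range (star f k) n≤k* (≤-trans k*≤end* (≤-reflexive (sym (m+[n∸m]≡n n≤end*))))
  where
  n≤k* : n ≤ star f k
  n≤k* = ≤-star inc fn≤k
  k*≤end* : star f k ≤ star f (f n + g (f n))
  k*≤end* = star-mono f k≤end
  n≤end* : n ≤ star f (f n + g (f n))
  n≤end* = ≤-trans n≤k* k*≤end*
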